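{- Let $P(X) \in \mathbb{Z}[X]$ be a monic non-constant polynomial. Then there are at most finitely many composite positive integers $n$ such that $S_2(n) \mid \phi(n) - 1$ and $P(S_2(n)) \equiv 0 \pmod{\phi(n)}$, where $\phi$ is Euler's totient function and $S_2(n) = n\prod_{p \mid n}\left(1 - \frac{2}{p}\right)$.
   Context: $S_2$ is Schemmel's totient function, $S_2(n) = n\prod_{p\mid n}(1-2/p)$, the product being over the distinct primes dividing $n$. -}

module Defs where

open import Data.Nat as ℕ using (ℕ; zero; suc; _∸_)
open import Data.Nat.Divisibility using (_∣?_)
open import Data.Nat.GCD using (gcd)
open import Data.Nat.Primality using (prime?)
open import Data.Nat.DivMod using (_/_)
open import Data.List using (List; []; _∷_; filter; length; map; upTo; last; applyUpTo)
open import Data.Nat.ListAction using (product)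
open import Data.Maybe using (just)
open import Data.Integer as ℤ using (ℤ)
open import Data.Product using (_×_)
open import Relation.Binary.PropositionalEquality using (_≡_)
open import Relation.Nullary.Decidable using (_×-dec_)

-- the distinct primes dividing n (for n ≥ 1 they all lie in [0, n])
primeDivisors : ℕ → List ℕ
primeDivisors n = filter (λ p → prime? p ×-dec (p ∣? n)) (upTo (suc n))

φ : ℕ → ℕ
φ n = length (filter (λ k → gcd k n ℕ.≟ 1) (applyUpTo suc n))

-- Schemmel's totient S₂(n) = n ∏_{p ∣ n} (1 - 2/p) = n ∏ (p - 2) / ∏ p
-- (the division is exact since ∏_{p∣n} p divides n)
S₂ : ℕ → ℕ
S₂ n = (n ℕ.* product (map (λ p → p ∸ 2) (primeDivisors n)))
         / suc (product (primeDivisors n) ∸ 1)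

-- integer polynomials as coefficient lists, constant term first
Poly : Set
Poly = List ℤ

eval : Poly → ℤ → ℤ
eval [] x = ℤ.0ℤ
eval (c ∷ cs) x = c ℤ.+ x ℤ.* eval cs x

Monic : Poly → Set
Monic P = last P ≡ just ℤ.1ℤ

-- degree ≥ 1, i.e. at least two coefficients (with monic: leading coeff 1 at index ≥ 1)
NonConstant : Poly → Set
NonConstant P = 2 ℕ.≤ length P

module Submission where

-- Write n = c · rad n. By multiplicativity of φ, φ(n) = c ∏ (p - 1) and S₂(n) = c ∏ (p - 2), the products
-- running over the primes p ∣ n. If φ(n) = k S₂(n) + 1, then n is odd (otherwise S₂(n) = 0), k = 0 is
-- impossible, and k = 1 forces n to be prime. For k ≥ 2, k S₂ ≡ -1 modulo φ, so φ divides the value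
-- k^(d+1) P(S₂) ≡ k · k^d P(-1/k), which is nonzero (it is ±1 mod k as P is monic) and at most ‖P‖₁ k^(d+1)
-- in absolute value; hence S₂ < ‖P‖₁ k^(d+1). With k ∏ (p - 2) < ∏ (p - 1) ≤ rad n this gives
-- n ∏ (p - 2)^E ≤ ‖P‖₁ (rad n)^E for E = d + 2. Finally p^(2E) ≤ p (p - 2)^(2E) for all primes p ≥ T = 3^(2E),
-- so (rad n)^(2E) ≤ T^T · rad n · ∏ (p - 2)^(2E); squaring the previous bound then gives n ≤ ‖P‖₁² T^T.

open import Level using (Level)
open import Data.Empty using (⊥-elim)
open import Data.Bool using (true; false)
open import Data.Maybe using (just)
open import Data.Product using (∃; _×_; _,_; proj₁; proj₂)
open import Data.Sum using (_⊎_; inj₁; inj₂)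
open import Data.List using (List; []; _∷_; _++_; _∷ʳ_; filter; length; last; map; applyUpTo; upTo)
open import Data.List.Properties
  using (filter-++; filter-≐; filter-accept; filter-reject; map-id; map-++; length-++; ++-identityʳ; applyUpTo-∷ʳ; upTo-∷ʳ)
open import Data.List.Relation.Unary.All as All using (All; []; _∷_)
open import Data.List.Relation.Unary.Any using (here)
open import Data.List.Membership.Propositional using (_∈_)
open import Data.List.Membership.Propositional.Properties using (∈-upTo⁺; ∈-upTo⁻; ∈-filter⁺; ∈-filter⁻; ∈-map⁺)
open import Function using (id; _∘′_)
open import Relation.Nullary using (Dec; does; yes; no; ¬_)
open import Relation.Nullary.Decidable using (_×-dec_)
open import Relation.Unary using (Pred; Decidable)
open import Relation.Binary.PropositionalEquality
open import Defs

module _ where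
  open import Data.Nat
  open import Data.Nat.Properties
  open import Data.Nat.Divisibility
  open import Data.Nat.DivMod using (_/_; m*n/n≡m)
  open import Data.Nat.GCD using (gcd)
  open import Data.Nat.Coprimality using (Coprime; coprime?; coprime⇒gcd≡1; gcd≡1⇒coprime; coprime-divisor)
  open import Data.Nat.Primality
    using (Prime; Composite; composite; prime?; prime[2]; ¬prime[0]; ¬prime[1]; euclidsLemma; prime⇒irreducible
          ; prime⇒nonZero; composite⇒¬prime; composite⇒nonZero; productOfPrimes≢0)
  open import Data.Nat.Primality.Factorisation using (factorise; module PrimeFactorisation)
  open import Data.Nat.ListAction using (product)
  open import Data.Nat.ListAction.Properties using (product-++; ∈⇒∣product)
  open import Data.Nat.Tactic.RingSolver using (solve-∀)

  private
    variable
      ℓ : Level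
      X Y : Set ℓ
      k m n p N : ℕ
      f g h : ℕ → ℕ

  -- Sums over initial segments

  𝟙 : Dec X → ℕ
  𝟙 (yes _) = 1
  𝟙 (no _)  = 0

  𝟙-yes : (X? : Dec X) → X → 𝟙 X? ≡ 1
  𝟙-yes (yes _) _  = refl
  𝟙-yes (no ¬p) p  = ⊥-elim (¬p p)

  𝟙-no : (X? : Dec X) → ¬ X → 𝟙 X? ≡ 0
  𝟙-no (yes p) ¬p = ⊥-elim (¬p p)
  𝟙-no (no _)  _  = refl

  𝟙-cong : (X → Y) → (Y → X) → (X? : Dec X) (Y? : Dec Y) → 𝟙 X? ≡ 𝟙 Y?
  𝟙-cong X⇒Y Y⇒X (yes a) Y? = sym (𝟙-yes Y? (X⇒Y a))
  𝟙-cong X⇒Y Y⇒X (no ¬a) Y? = sym (𝟙-no Y? (λ b → ¬a (Y⇒X b)))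

  ∑< : ℕ → (ℕ → ℕ) → ℕ
  ∑< zero    g = 0
  ∑< (suc N) g = ∑< N g + g N

  ∑<-cong : ∀ N → (∀ {i} → i < N → g i ≡ h i) → ∑< N g ≡ ∑< N h
  ∑<-cong zero    eq = refl
  ∑<-cong (suc N) eq = cong₂ _+_ (∑<-cong N (λ i<N → eq (m<n⇒m<1+n i<N))) (eq (n<1+n N))

  ∑<-zero : ∀ N → (∀ {i} → i < N → g i ≡ 0) → ∑< N g ≡ 0
  ∑<-zero zero    z = refl
  ∑<-zero (suc N) z = cong₂ _+_ (∑<-zero N (λ i<N → z (m<n⇒m<1+n i<N))) (z (n<1+n N))

  ∑<-distrib : ∀ N g h → ∑< N (λ i → g i + h i) ≡ ∑< N g + ∑< N h
  ∑<-distrib zero    g h = refl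
  ∑<-distrib (suc N) g h =
    trans (cong (_+ (g N + h N)) (∑<-distrib N g h)) (interchange (∑< N g) (∑< N h) (g N) (h N))
    where
    interchange : ∀ a b c d → a + b + (c + d) ≡ a + c + (b + d)
    interchange = solve-∀

  ∑<-+ : ∀ a b g → ∑< (a + b) g ≡ ∑< a g + ∑< b (λ i → g (a + i))
  ∑<-+ a zero    g = trans (cong (λ t → ∑< t g) (+-identityʳ a)) (sym (+-identityʳ _))
  ∑<-+ a (suc b) g = begin
    ∑< (a + suc b) g                                 ≡⟨ cong (λ t → ∑< t g) (+-suc a b) ⟩
    ∑< (a + b) g + g (a + b)                         ≡⟨ cong (_+ g (a + b)) (∑<-+ a b g) ⟩
    ∑< a g + ∑< b (λ i → g (a + i)) + g (a + b)      ≡⟨ +-assoc (∑< a g) _ _ ⟩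
    ∑< a g + ∑< (suc b) (λ i → g (a + i))            ∎
    where open ≡-Reasoning

  ∑<-periodic : ∀ m g → (∀ i → g (m + i) ≡ g i) → ∀ j → ∑< (j * m) g ≡ j * ∑< m g
  ∑<-periodic m g periodic zero    = refl
  ∑<-periodic m g periodic (suc j) = begin
    ∑< (m + j * m) g                         ≡⟨ ∑<-+ m (j * m) g ⟩
    ∑< m g + ∑< (j * m) (λ i → g (m + i))    ≡⟨ cong (∑< m g +_) (∑<-cong (j * m) (λ {i} _ → periodic i)) ⟩
    ∑< m g + ∑< (j * m) g                    ≡⟨ cong (∑< m g +_) (∑<-periodic m g periodic j) ⟩
    ∑< m g + j * ∑< m g                      ∎
    where open ≡-Reasoning

  length-filter-applyUpTo : ∀ {P : Pred ℕ ℓ} (P? : Decidable P) N →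
    length (filter P? (applyUpTo suc N)) ≡ ∑< N (λ i → 𝟙 (P? (suc i)))
  length-filter-applyUpTo P? zero    = refl
  length-filter-applyUpTo P? (suc N) = begin
    length (filter P? (applyUpTo suc (suc N)))                     ≡⟨ cong (length ∘′ filter P?) (applyUpTo-∷ʳ suc N) ⟨
    length (filter P? (applyUpTo suc N ∷ʳ suc N))                  ≡⟨ cong length (filter-++ P? (applyUpTo suc N) _) ⟩
    length (filter P? (applyUpTo suc N) ++ filter P? (suc N ∷ [])) ≡⟨ length-++ (filter P? (applyUpTo suc N)) ⟩
    length (filter P? (applyUpTo suc N)) + length (filter P? (suc N ∷ []))
      ≡⟨ cong₂ _+_ (length-filter-applyUpTo P? N) (length-filter-[] (suc N)) ⟩
    ∑< (suc N) (λ i → 𝟙 (P? (suc i)))                              ∎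
    where
    open ≡-Reasoning
    length-filter-[] : ∀ x → length (filter P? (x ∷ [])) ≡ 𝟙 (P? x)
    length-filter-[] x with P? x
    ... | yes _ = refl
    ... | no _  = refl

  term≤∑< : ∀ {i} N → i < N → g i ≤ ∑< N g
  term≤∑< {g} {i} (suc N) i<1+N with i ≟ N
  ... | yes refl = m≤n+m (g i) (∑< N g)
  ... | no i≢N   = ≤-trans (term≤∑< N (≤∧≢⇒< (≤-pred i<1+N) i≢N)) (m≤m+n (∑< N g) (g N))

  -- Products over lists

  product-map-mono : ∀ {xs} → All (λ x → f x ≤ g x) xs → product (map f xs) ≤ product (map g xs)
  product-map-mono []         = ≤-refl
  product-map-mono (le ∷ les) = *-mono-≤ le (product-map-mono les)

  product-map-≥1 : ∀ {xs} → All (λ x → 1 ≤ f x) xs → 1 ≤ product (map f xs)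
  product-map-≥1 []         = ≤-refl
  product-map-≥1 (le ∷ les) = *-mono-≤ le (product-map-≥1 les)

  product-map-* : ∀ f g (xs : List ℕ) →
                  product (map (λ x → f x * g x) xs) ≡ product (map f xs) * product (map g xs)
  product-map-* f g []       = refl
  product-map-* f g (x ∷ xs) = begin
    f x * g x * product (map (λ x → f x * g x) xs)   ≡⟨ cong (f x * g x *_) (product-map-* f g xs) ⟩
    f x * g x * (product (map f xs) * product (map g xs))
      ≡⟨ interchange (f x) (g x) (product (map f xs)) (product (map g xs)) ⟩
    f x * product (map f xs) * (g x * product (map g xs)) ∎
    where
    open ≡-Reasoning
    interchange : ∀ a b c d → a * b * (c * d) ≡ a * c * (b * d)
    interchange = solve-∀

  ^-distribʳ-* : ∀ a b D → (a * b) ^ D ≡ a ^ D * b ^ D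
  ^-distribʳ-* a b zero    = refl
  ^-distribʳ-* a b (suc D) = begin
    a * b * (a * b) ^ D     ≡⟨ cong (a * b *_) (^-distribʳ-* a b D) ⟩
    a * b * (a ^ D * b ^ D) ≡⟨ interchange a b (a ^ D) (b ^ D) ⟩
    a * a ^ D * (b * b ^ D) ∎
    where
    open ≡-Reasoning
    interchange : ∀ a b c d → a * b * (c * d) ≡ a * c * (b * d)
    interchange = solve-∀

  product-map-^ : ∀ f D (xs : List ℕ) → product (map (λ x → f x ^ D) xs) ≡ product (map f xs) ^ D
  product-map-^ f D []       = sym (^-zeroˡ D)
  product-map-^ f D (x ∷ xs) = trans (cong (f x ^ D *_) (product-map-^ f D xs)) (sym (^-distribʳ-* (f x) _ D))

  module _ {P : Pred ℕ ℓ} (P? : Decidable P) where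

    product-map-filter-≤ : ∀ f → (∀ x → 1 ≤ f x) → ∀ xs →
                           product (map f (filter P? xs)) ≤ product (map f xs)
    product-map-filter-≤ f f≥1 []       = ≤-refl
    product-map-filter-≤ f f≥1 (x ∷ xs) with does (P? x)
    ... | true  = *-monoʳ-≤ (f x) (product-map-filter-≤ f f≥1 xs)
    ... | false = ≤-trans (product-map-filter-≤ f f≥1 xs) (m≤n*m _ (f x) {{>-nonZero (f≥1 x)}})

    filter-upTo-suc : ∀ N → filter P? (upTo (suc N)) ≡ filter P? (upTo N) ++ filter P? (N ∷ [])
    filter-upTo-suc N = trans (cong (filter P?) (sym (upTo-∷ʳ N))) (filter-++ P? (upTo N) (N ∷ []))

    product-map-filter-upTo-suc : ∀ f N → product (map f (filter P? (upTo (suc N)))) ≡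
      product (map f (filter P? (upTo N))) * product (map f (filter P? (N ∷ [])))
    product-map-filter-upTo-suc f N = begin
      product (map f (filter P? (upTo (suc N))))
        ≡⟨ cong (product ∘′ map f) (filter-upTo-suc N) ⟩
      product (map f (filter P? (upTo N) ++ filter P? (N ∷ [])))
        ≡⟨ cong product (map-++ f (filter P? (upTo N)) _) ⟩
      product (map f (filter P? (upTo N)) ++ map f (filter P? (N ∷ [])))
        ≡⟨ product-++ (map f (filter P? (upTo N))) _ ⟩
      product (map f (filter P? (upTo N))) * product (map f (filter P? (N ∷ []))) ∎
      where open ≡-Reasoning

    filter-upTo-extend : ∀ {N N′} → (∀ {x} → N ≤ x → ¬ P x) → N ≤ N′ →
                         filter P? (upTo N′) ≡ filter P? (upTo N)
    filter-upTo-extend {N} none N≤N′ = go (≤⇒≤′ N≤N′)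
      where
      go : ∀ {N′} → N ≤′ N′ → filter P? (upTo N′) ≡ filter P? (upTo N)
      go ≤′-refl                = refl
      go (≤′-step {N′} N≤′N′) = begin
        filter P? (upTo (suc N′))                  ≡⟨ filter-upTo-suc N′ ⟩
        filter P? (upTo N′) ++ filter P? (N′ ∷ [])
          ≡⟨ cong (filter P? (upTo N′) ++_) (filter-reject P? (none (≤′⇒≤ N≤′N′))) ⟩
        filter P? (upTo N′) ++ []                  ≡⟨ ++-identityʳ _ ⟩
        filter P? (upTo N′)                        ≡⟨ go N≤′N′ ⟩
        filter P? (upTo N)                         ∎
        where open ≡-Reasoning

  module _ {P : Pred ℕ ℓ} {Q : Pred ℕ ℓ} (P? : Decidable P) (Q? : Decidable Q) where

    filter-cong : ∀ {xs} → All (λ x → (P x → Q x) × (Q x → P x)) xs → filter P? xs ≡ filter Q? xs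
    filter-cong {[]}     []                     = refl
    filter-cong {x ∷ xs} ((P⇒Q , Q⇒P) ∷ agree) with P? x
    ... | yes Px = trans (cong (x ∷_) (filter-cong agree)) (sym (filter-accept Q? (P⇒Q Px)))
    ... | no ¬Px = trans (filter-cong agree) (sym (filter-reject Q? (λ Qx → ¬Px (Q⇒P Qx))))

    filter-upTo-cong : ∀ N → (∀ {x} → x < N → (P x → Q x) × (Q x → P x)) →
                       filter P? (upTo N) ≡ filter Q? (upTo N)
    filter-upTo-cong N agree = filter-cong (All.tabulate (λ x∈ → agree (∈-upTo⁻ x∈)))

    product-map-filter-upTo-insert : ∀ f p N → p < N → P p → ¬ Q p →
      (∀ {x} → x < N → x ≢ p → (P x → Q x) × (Q x → P x)) →
      product (map f (filter P? (upTo N))) ≡ f p * product (map f (filter Q? (upTo N)))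
    product-map-filter-upTo-insert f p (suc N) p<1+N Pp ¬Qp agree with p ≟ N
    ... | yes refl = begin
      product (map f (filter P? (upTo (suc p))))
        ≡⟨ product-map-filter-upTo-suc P? f p ⟩
      product (map f (filter P? (upTo p))) * product (map f (filter P? (p ∷ [])))
        ≡⟨ cong₂ (λ xs ys → product (map f xs) * product (map f ys))
                 (filter-upTo-cong p (λ x<p → agree (m<n⇒m<1+n x<p) (<⇒≢ x<p)))
                 (filter-accept P? Pp) ⟩
      product (map f (filter Q? (upTo p))) * (f p * 1)
        ≡⟨ swap (product (map f (filter Q? (upTo p)))) (f p) ⟩
      f p * (product (map f (filter Q? (upTo p))) * 1)
        ≡⟨ cong (λ ys → f p * (product (map f (filter Q? (upTo p))) * product (map f ys))) (filter-reject Q? ¬Qp) ⟨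
      f p * (product (map f (filter Q? (upTo p))) * product (map f (filter Q? (p ∷ []))))
        ≡⟨ cong (f p *_) (product-map-filter-upTo-suc Q? f p) ⟨
      f p * product (map f (filter Q? (upTo (suc p)))) ∎
      where
      open ≡-Reasoning
      swap : ∀ a b → a * (b * 1) ≡ b * (a * 1)
      swap = solve-∀
    ... | no p≢N = begin
      product (map f (filter P? (upTo (suc N))))
        ≡⟨ product-map-filter-upTo-suc P? f N ⟩
      product (map f (filter P? (upTo N))) * product (map f (filter P? (N ∷ [])))
        ≡⟨ cong₂ _*_ (product-map-filter-upTo-insert f p N p<N Pp ¬Qp (λ x<N → agree (m<n⇒m<1+n x<N)))
                     (cong (product ∘′ map f) (filter-cong (agree (n<1+n N) (λ N≡p → p≢N (sym N≡p)) ∷ []))) ⟩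
      f p * product (map f (filter Q? (upTo N))) * product (map f (filter Q? (N ∷ [])))
        ≡⟨ *-assoc (f p) _ _ ⟩
      f p * (product (map f (filter Q? (upTo N))) * product (map f (filter Q? (N ∷ []))))
        ≡⟨ cong (f p *_) (product-map-filter-upTo-suc Q? f N) ⟨
      f p * product (map f (filter Q? (upTo (suc N)))) ∎
      where
      open ≡-Reasoning
      p<N : p < N
      p<N = ≤∧≢⇒< (≤-pred p<1+N) p≢N

  -- Euler's totient

  prime≢1 : Prime p → p ≢ 1
  prime≢1 pp refl = ¬prime[1] pp

  coprime-* : ∀ {a b} → Coprime k a → Coprime k b → Coprime k (a * b)
  coprime-* {k} {a} k⊥a k⊥b {d} (d∣k , d∣ab) = k⊥b (d∣k , coprime-divisor d⊥a d∣ab)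
    where
    d⊥a : Coprime d a
    d⊥a (e∣d , e∣a) = k⊥a (∣-trans e∣d d∣k , e∣a)

  prime∤⇒coprime : Prime p → ¬ p ∣ k → Coprime k p
  prime∤⇒coprime pp p∤k (d∣k , d∣p) with prime⇒irreducible pp d∣p
  ... | inj₁ d≡1 = d≡1
  ... | inj₂ refl = ⊥-elim (p∤k d∣k)

  coprime𝟙 : ℕ → ℕ → ℕ
  coprime𝟙 k m = 𝟙 (gcd k m ≟ 1)

  coprime𝟙-yes : Coprime k m → coprime𝟙 k m ≡ 1
  coprime𝟙-yes {k} {m} c = 𝟙-yes (gcd k m ≟ 1) (coprime⇒gcd≡1 c)

  coprime𝟙-no : ¬ Coprime k m → coprime𝟙 k m ≡ 0
  coprime𝟙-no {k} {m} ¬c = 𝟙-no (gcd k m ≟ 1) (λ e → ¬c (gcd≡1⇒coprime e))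

  coprime𝟙-cong : ∀ {k′ m′} → (Coprime k m → Coprime k′ m′) → (Coprime k′ m′ → Coprime k m) →
                  coprime𝟙 k m ≡ coprime𝟙 k′ m′
  coprime𝟙-cong {k} {m} {k′} {m′} ⇒ ⇐ = 𝟙-cong
    (λ e → coprime⇒gcd≡1 (⇒ (gcd≡1⇒coprime e))) (λ e → coprime⇒gcd≡1 (⇐ (gcd≡1⇒coprime e)))
    (gcd k m ≟ 1) (gcd k′ m′ ≟ 1)

  coprime𝟙-+ : ∀ m k → coprime𝟙 (m + k) m ≡ coprime𝟙 k m
  coprime𝟙-+ m k = coprime𝟙-cong {m + k} {m} {k} {m}
    (λ c (d∣k , d∣m) → c (∣m∣n⇒∣m+n d∣m d∣k , d∣m))
    (λ c (d∣m+k , d∣m) → c (∣m+n∣m⇒∣n d∣m+k d∣m , d∣m))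

  coprime𝟙-split : Prime p → ∀ k → coprime𝟙 k (p * m) + coprime𝟙 k m * 𝟙 (p ∣? k) ≡ coprime𝟙 k m
  coprime𝟙-split {p} {m} pp k with coprime? k m | p ∣? k
  ... | no ¬k⊥m | _ rewrite coprime𝟙-no ¬k⊥m
                          | coprime𝟙-no {k} {p * m} (λ c → ¬k⊥m (λ (d∣k , d∣m) → c (d∣k , ∣n⇒∣m*n p d∣m)))
                          = refl
  ... | yes k⊥m | yes p∣k rewrite coprime𝟙-yes k⊥m
                                | coprime𝟙-no {k} {p * m} (λ c → prime≢1 pp (c (p∣k , m∣m*n m))) = refl
  ... | yes k⊥m | no p∤k rewrite coprime𝟙-yes k⊥m
                               | coprime𝟙-yes (coprime-* (prime∤⇒coprime pp p∤k) k⊥m) = refl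

  φ≡∑ : ∀ n → φ n ≡ ∑< n (λ i → coprime𝟙 (suc i) n)
  φ≡∑ n = length-filter-applyUpTo (λ k → gcd k n ≟ 1) n

  ∑<-multiples : ∀ p .{{_ : NonZero p}} (G : ℕ → ℕ) N →
    ∑< (p * N) (λ i → G (suc i) * 𝟙 (p ∣? suc i)) ≡ ∑< N (λ j → G (p * suc j))
  ∑<-multiples p         G zero    = cong (λ t → ∑< t (λ i → G (suc i) * 𝟙 (p ∣? suc i))) (*-zeroʳ p)
  ∑<-multiples p@(suc q) G (suc N) = begin
    ∑< (p * suc N) H                           ≡⟨ cong (λ t → ∑< t H) (trans (*-suc p N) (+-comm p (p * N))) ⟩
    ∑< (p * N + p) H                           ≡⟨ ∑<-+ (p * N) p H ⟩
    ∑< (p * N) H + ∑< p (λ r → H (p * N + r))  ≡⟨ cong₂ _+_ (∑<-multiples p G N) lastBlock ⟩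
    ∑< (suc N) (λ j → G (p * suc j))           ∎
    where
    open ≡-Reasoning
    H : ℕ → ℕ
    H i = G (suc i) * 𝟙 (p ∣? suc i)
    notMultiple : ∀ {r} → r < q → H (p * N + r) ≡ 0
    notMultiple {r} r<q =
      trans (cong (G (suc (p * N + r)) *_) (𝟙-no (p ∣? suc (p * N + r)) p∤)) (*-zeroʳ (G (suc (p * N + r))))
      where
      p∤ : ¬ p ∣ suc (p * N + r)
      p∤ p∣ = <⇒≱ (s≤s r<q) (∣⇒≤ (∣m+n∣m⇒∣n (subst (p ∣_) (sym (+-suc (p * N) r)) p∣) (m∣m*n N)))
    lastBlock : ∑< p (λ r → H (p * N + r)) ≡ G (p * suc N)
    lastBlock = begin
      ∑< q (λ r → H (p * N + r)) + H (p * N + q)      ≡⟨ cong (_+ H (p * N + q)) (∑<-zero q notMultiple) ⟩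
      G (suc (p * N + q)) * 𝟙 (p ∣? suc (p * N + q))  ≡⟨ cong (λ t → G t * 𝟙 (p ∣? t)) p*N+p≡p*[1+N] ⟩
      G (p * suc N) * 𝟙 (p ∣? p * suc N)              ≡⟨ cong (G (p * suc N) *_) (𝟙-yes (p ∣? _) (m∣m*n (suc N))) ⟩
      G (p * suc N) * 1                               ≡⟨ *-identityʳ _ ⟩
      G (p * suc N)                                   ∎
      where
      p*N+p≡p*[1+N] : suc (p * N + q) ≡ p * suc N
      p*N+p≡p*[1+N] = trans (sym (+-suc (p * N) q)) (trans (+-comm (p * N) p) (sym (*-suc p N)))

  -- Among 1, …, p m the residues coprime to m fall into p full periods; those coprime to
  -- m but not to p m are exactly the multiples p j with p j coprime to m.
  φ[p*m]+∑≡p*φ[m] : Prime p → φ (p * m) + ∑< m (λ j → coprime𝟙 (p * suc j) m) ≡ p * φ m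
  φ[p*m]+∑≡p*φ[m] {p} {m} pp = begin
    φ (p * m) + ∑< m (λ j → coprime𝟙 (p * suc j) m)
      ≡⟨ cong₂ _+_ (φ≡∑ (p * m)) (sym (∑<-multiples p {{prime⇒nonZero pp}} (λ k → coprime𝟙 k m) m)) ⟩
    ∑< (p * m) (λ i → coprime𝟙 (suc i) (p * m)) + ∑< (p * m) (λ i → coprime𝟙 (suc i) m * 𝟙 (p ∣? suc i))
      ≡⟨ ∑<-distrib (p * m) _ _ ⟨
    ∑< (p * m) (λ i → coprime𝟙 (suc i) (p * m) + coprime𝟙 (suc i) m * 𝟙 (p ∣? suc i))
      ≡⟨ ∑<-cong (p * m) (λ {i} _ → coprime𝟙-split pp (suc i)) ⟩
    ∑< (p * m) (λ i → coprime𝟙 (suc i) m)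
      ≡⟨ ∑<-periodic m _ (λ i → trans (cong (λ t → coprime𝟙 t m) (sym (+-suc m i))) (coprime𝟙-+ m (suc i))) p ⟩
    p * ∑< m (λ i → coprime𝟙 (suc i) m)
      ≡⟨ cong (p *_) (φ≡∑ m) ⟨
    p * φ m ∎
    where open ≡-Reasoning

  φ[p*m]≡p*φ[m] : Prime p → p ∣ m → φ (p * m) ≡ p * φ m
  φ[p*m]≡p*φ[m] {p} {m} pp p∣m = begin
    φ (p * m)                                        ≡⟨ +-identityʳ _ ⟨
    φ (p * m) + 0                                    ≡⟨ cong (φ (p * m) +_) (∑<-zero m p∣gcd) ⟨
    φ (p * m) + ∑< m (λ j → coprime𝟙 (p * suc j) m)  ≡⟨ φ[p*m]+∑≡p*φ[m] pp ⟩
    p * φ m                                          ∎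
    where
    open ≡-Reasoning
    p∣gcd : ∀ {j} → j < m → coprime𝟙 (p * suc j) m ≡ 0
    p∣gcd {j} _ = coprime𝟙-no (λ c → prime≢1 pp (c (m∣m*n (suc j) , p∣m)))

  φ[p*m]≡[p∸1]*φ[m] : Prime p → ¬ p ∣ m → φ (p * m) ≡ (p ∸ 1) * φ m
  φ[p*m]≡[p∸1]*φ[m] {p} {m} pp p∤m = begin
    φ (p * m)                  ≡⟨ m+n∸n≡m (φ (p * m)) (φ m) ⟨
    φ (p * m) + φ m ∸ φ m
      ≡⟨ cong (λ t → φ (p * m) + t ∸ φ m) (trans (φ≡∑ m) (∑<-cong m (λ {j} _ → sym (p*-invariant (suc j))))) ⟩
    φ (p * m) + ∑< m (λ j → coprime𝟙 (p * suc j) m) ∸ φ m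
                               ≡⟨ cong (_∸ φ m) (φ[p*m]+∑≡p*φ[m] pp) ⟩
    p * φ m ∸ φ m              ≡⟨ cong (p * φ m ∸_) (*-identityˡ (φ m)) ⟨
    p * φ m ∸ 1 * φ m          ≡⟨ *-distribʳ-∸ (φ m) p 1 ⟨
    (p ∸ 1) * φ m              ∎
    where
    open ≡-Reasoning
    m⊥p : Coprime m p
    m⊥p = prime∤⇒coprime pp p∤m
    p*-invariant : ∀ k → coprime𝟙 (p * k) m ≡ coprime𝟙 k m
    p*-invariant k = coprime𝟙-cong {p * k} {m} {k} {m}
      (λ c (d∣k , d∣m) → c (∣n⇒∣m*n p d∣k , d∣m))
      (λ c {d} (d∣pk , d∣m) → c (coprime-divisor (λ (e∣d , e∣p) → m⊥p (∣-trans e∣d d∣m , e∣p)) d∣pk , d∣m))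

  composite⇒3≤ : Composite n → 3 ≤ n
  composite⇒3≤ (composite {d} d<n _) = ≤-trans (s≤s (nonTrivial⇒n>1 d)) d<n

  -- 1 and n - 1 are coprime to n.
  φ≥2 : 3 ≤ n → 2 ≤ φ n
  φ≥2 {1}                     (s≤s ())
  φ≥2 {2}                     (s≤s (s≤s ()))
  φ≥2 {n@(suc (suc (suc j)))} _ = begin
    2                                                 ≡⟨ cong₂ _+_ (coprime𝟙-yes 1⊥n) (coprime𝟙-yes [n-1]⊥n) ⟨
    coprime𝟙 1 n + coprime𝟙 (suc (suc j)) n           ≤⟨ +-monoˡ-≤ _ (term≤∑< (suc j) (s≤s z≤n)) ⟩
    ∑< (suc (suc j)) (λ i → coprime𝟙 (suc i) n)       ≤⟨ m≤m+n _ _ ⟩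
    ∑< n (λ i → coprime𝟙 (suc i) n)                   ≡⟨ φ≡∑ n ⟨
    φ n                                               ∎
    where
    open ≤-Reasoning
    1⊥n : Coprime 1 n
    1⊥n (d∣1 , _) = ∣1⇒≡1 d∣1
    [n-1]⊥n : Coprime (suc (suc j)) n
    [n-1]⊥n {d} (d∣n-1 , d∣n) = ∣1⇒≡1 (∣m+n∣m⇒∣n (subst (d ∣_) (+-comm 1 (suc (suc j))) d∣n) d∣n-1)

  φ≢1 : Composite n → φ n ≢ 1
  φ≢1 comp φ≡1 = <⇒≢ (φ≥2 (composite⇒3≤ comp)) (sym φ≡1)

  -- Products over the prime divisors

  prime-divisor-of-* : ∀ {x} → Prime p → Prime x → x ∣ p * m → x ≡ p ⊎ x ∣ m
  prime-divisor-of-* {p} {m} pp px x∣pm with euclidsLemma p m px x∣pm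
  ... | inj₂ x∣m = inj₂ x∣m
  ... | inj₁ x∣p with prime⇒irreducible pp x∣p
  ...   | inj₁ x≡1 = ⊥-elim (prime≢1 px x≡1)
  ...   | inj₂ x≡p = inj₁ x≡p

  primeDivisor? : ∀ n → Decidable (λ p → Prime p × p ∣ n)
  primeDivisor? n p = prime? p ×-dec (p ∣? n)

  ∈-primeDivisors⁻ : p ∈ primeDivisors n → Prime p × p ∣ n
  ∈-primeDivisors⁻ {n = n} p∈ = proj₂ (∈-filter⁻ (primeDivisor? n) {xs = upTo (suc n)} p∈)

  ∈-primeDivisors⁺ : .{{NonZero n}} → Prime p → p ∣ n → p ∈ primeDivisors n
  ∈-primeDivisors⁺ {n} pp p∣n = ∈-filter⁺ (primeDivisor? n) (∈-upTo⁺ (s≤s (∣⇒≤ p∣n))) (pp , p∣n)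

  all-primeDivisors : ∀ {P : Pred ℕ ℓ} n → (∀ {p} → Prime p → p ∣ n → P p) → All P (primeDivisors n)
  all-primeDivisors n h = All.tabulate (λ p∈ → let (pp , p∣n) = ∈-primeDivisors⁻ p∈ in h pp p∣n)

  primeDivisors≡filter-upTo : .{{NonZero n}} → n < N → primeDivisors n ≡ filter (primeDivisor? n) (upTo N)
  primeDivisors≡filter-upTo {n} n<N =
    sym (filter-upTo-extend (primeDivisor? n) (λ n<x (_ , x∣n) → <⇒≱ n<x (∣⇒≤ x∣n)) n<N)

  primeDivisors-*-∣ : Prime p → .{{NonZero m}} → p ∣ m → primeDivisors (p * m) ≡ primeDivisors m
  primeDivisors-*-∣ {p} {m} pp p∣m = begin
    filter (primeDivisor? (p * m)) (upTo (suc (p * m)))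
      ≡⟨ filter-≐ (primeDivisor? (p * m)) (primeDivisor? m) (prime∣p*m⇒∣m , prime∣m⇒∣p*m) (upTo (suc (p * m))) ⟩
    filter (primeDivisor? m) (upTo (suc (p * m)))
      ≡⟨ primeDivisors≡filter-upTo (s≤s (m≤n*m m p {{prime⇒nonZero pp}})) ⟨
    primeDivisors m ∎
    where
    open ≡-Reasoning
    prime∣p*m⇒∣m : ∀ {x} → Prime x × x ∣ p * m → Prime x × x ∣ m
    prime∣p*m⇒∣m (px , x∣pm) with prime-divisor-of-* pp px x∣pm
    ... | inj₁ refl = px , p∣m
    ... | inj₂ x∣m  = px , x∣m
    prime∣m⇒∣p*m : ∀ {x} → Prime x × x ∣ m → Prime x × x ∣ p * m
    prime∣m⇒∣p*m (px , x∣m) = px , ∣n⇒∣m*n p x∣m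

  ∏ₚ : (ℕ → ℕ) → ℕ → ℕ
  ∏ₚ f n = product (map f (primeDivisors n))

  rad : ℕ → ℕ
  rad n = product (primeDivisors n)

  rad≡∏ₚid : ∀ n → rad n ≡ ∏ₚ id n
  rad≡∏ₚid n = cong product (sym (map-id (primeDivisors n)))

  rad≢0 : ∀ n → NonZero (rad n)
  rad≢0 n = productOfPrimes≢0 (all-primeDivisors n (λ pp _ → pp))

  ∏ₚ-*-∣ : ∀ f → Prime p → .{{NonZero m}} → p ∣ m → ∏ₚ f (p * m) ≡ ∏ₚ f m
  ∏ₚ-*-∣ f pp p∣m = cong (product ∘′ map f) (primeDivisors-*-∣ pp p∣m)

  ∏ₚ-*-∤ : ∀ f → Prime p → .{{NonZero m}} → ¬ p ∣ m → ∏ₚ f (p * m) ≡ f p * ∏ₚ f m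
  ∏ₚ-*-∤ {p} {m} f pp p∤m = begin
    product (map f (filter (primeDivisor? (p * m)) (upTo (suc (p * m)))))
      ≡⟨ product-map-filter-upTo-insert (primeDivisor? (p * m)) (primeDivisor? m) f p (suc (p * m))
           (s≤s (m≤m*n p m)) (pp , m∣m*n m) (λ (_ , p∣m) → p∤m p∣m) agree ⟩
    f p * product (map f (filter (primeDivisor? m) (upTo (suc (p * m)))))
      ≡⟨ cong (λ xs → f p * product (map f xs)) (primeDivisors≡filter-upTo (s≤s (m≤n*m m p {{prime⇒nonZero pp}}))) ⟨
    f p * ∏ₚ f m ∎
    where
    open ≡-Reasoning
    agree : ∀ {x} → x < suc (p * m) → x ≢ p →
            (Prime x × x ∣ p * m → Prime x × x ∣ m) × (Prime x × x ∣ m → Prime x × x ∣ p * m)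
    agree _ x≢p .proj₁ (px , x∣pm) with prime-divisor-of-* pp px x∣pm
    ... | inj₁ x≡p = ⊥-elim (x≢p x≡p)
    ... | inj₂ x∣m = px , x∣m
    agree _ _ .proj₂ (px , x∣m) = px , ∣n⇒∣m*n p x∣m

  ∏ₚ-mono : ∀ f g n → (∀ {p} → Prime p → p ∣ n → f p ≤ g p) → ∏ₚ f n ≤ ∏ₚ g n
  ∏ₚ-mono f g n le = product-map-mono (all-primeDivisors n le)

  ∏ₚ-≥1 : ∀ f n → (∀ {p} → Prime p → p ∣ n → 1 ≤ f p) → 1 ≤ ∏ₚ f n
  ∏ₚ-≥1 f n pos = product-map-≥1 (all-primeDivisors n pos)

  ∏ₚ[p∸2]≡0 : .{{NonZero n}} → 2 ∣ n → ∏ₚ (_∸ 2) n ≡ 0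
  ∏ₚ[p∸2]≡0 2∣n = 0∣⇒≡0 (∈⇒∣product (∈-map⁺ (_∸ 2) (∈-primeDivisors⁺ prime[2] 2∣n)))

  odd⇒3≤primeDivisor : ¬ 2 ∣ n → Prime p → p ∣ n → 3 ≤ p
  odd⇒3≤primeDivisor {p = 0}             _   pp _   = ⊥-elim (¬prime[0] pp)
  odd⇒3≤primeDivisor {p = 1}             _   pp _   = ⊥-elim (¬prime[1] pp)
  odd⇒3≤primeDivisor {p = 2}             odd _  2∣n = ⊥-elim (odd 2∣n)
  odd⇒3≤primeDivisor {p = suc (suc (suc _))} _ _ _ = s≤s (s≤s (s≤s z≤n))

  -- φ and S₂ in terms of the prime divisors

  prime-induction : (Q : ℕ → Set ℓ) → Q 1 → (∀ {p m} → Prime p → .{{NonZero m}} → Q m → Q (p * m)) →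
                    ∀ n → .{{NonZero n}} → Q n
  prime-induction Q base step n = subst Q (sym isFactorisation) (go factorsPrime)
    where
    open PrimeFactorisation (factorise n)
    go : ∀ {ps} → All Prime ps → Q (product ps)
    go []         = base
    go (pp ∷ pps) = step pp {{productOfPrimes≢0 pps}} (go pps)

  rad∣n : ∀ n → .{{NonZero n}} → rad n ∣ n
  rad∣n = prime-induction (λ n → rad n ∣ n) ∣-refl step
    where
    step : Prime p → .{{NonZero m}} → rad m ∣ m → rad (p * m) ∣ p * m
    step {p} {m} pp rad∣m with p ∣? m
    ... | yes p∣m = subst (_∣ p * m) (cong product (sym (primeDivisors-*-∣ pp p∣m))) (∣n⇒∣m*n p rad∣m)
    ... | no p∤m  = subst (_∣ p * m) rad[p*m]≡p*rad[m] (*-monoʳ-∣ p rad∣m)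
      where
      rad[p*m]≡p*rad[m] : p * rad m ≡ rad (p * m)
      rad[p*m]≡p*rad[m] = begin
        p * rad m    ≡⟨ cong (p *_) (rad≡∏ₚid m) ⟩
        p * ∏ₚ id m  ≡⟨ ∏ₚ-*-∤ id pp p∤m ⟨
        ∏ₚ id (p * m) ≡⟨ rad≡∏ₚid (p * m) ⟨
        rad (p * m)  ∎
        where open ≡-Reasoning

  φ*rad≡n*∏ₚ[p∸1] : ∀ n → .{{NonZero n}} → φ n * rad n ≡ n * ∏ₚ (_∸ 1) n
  φ*rad≡n*∏ₚ[p∸1] = prime-induction (λ n → φ n * rad n ≡ n * ∏ₚ (_∸ 1) n) refl step
    where
    step : Prime p → .{{NonZero m}} → φ m * rad m ≡ m * ∏ₚ (_∸ 1) m →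
           φ (p * m) * rad (p * m) ≡ p * m * ∏ₚ (_∸ 1) (p * m)
    step {p} {m} pp ih with p ∣? m
    ... | yes p∣m = begin
      φ (p * m) * rad (p * m)      ≡⟨ cong₂ _*_ (φ[p*m]≡p*φ[m] pp p∣m) (cong product (primeDivisors-*-∣ pp p∣m)) ⟩
      p * φ m * rad m              ≡⟨ *-assoc p (φ m) (rad m) ⟩
      p * (φ m * rad m)            ≡⟨ cong (p *_) ih ⟩
      p * (m * ∏ₚ (_∸ 1) m)        ≡⟨ *-assoc p m _ ⟨
      p * m * ∏ₚ (_∸ 1) m          ≡⟨ cong (p * m *_) (∏ₚ-*-∣ (_∸ 1) pp p∣m) ⟨
      p * m * ∏ₚ (_∸ 1) (p * m)    ∎
      where open ≡-Reasoning
    ... | no p∤m = begin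
      φ (p * m) * rad (p * m)
        ≡⟨ cong₂ _*_ (φ[p*m]≡[p∸1]*φ[m] pp p∤m) (trans (rad≡∏ₚid (p * m)) (∏ₚ-*-∤ id pp p∤m)) ⟩
      (p ∸ 1) * φ m * (p * ∏ₚ id m)  ≡⟨ cong (λ t → (p ∸ 1) * φ m * (p * t)) (rad≡∏ₚid m) ⟨
      (p ∸ 1) * φ m * (p * rad m)    ≡⟨ regroup (p ∸ 1) (φ m) p (rad m) ⟩
      p * ((p ∸ 1) * (φ m * rad m))  ≡⟨ cong (λ t → p * ((p ∸ 1) * t)) ih ⟩
      p * ((p ∸ 1) * (m * ∏ₚ (_∸ 1) m)) ≡⟨ regroup′ p (p ∸ 1) m (∏ₚ (_∸ 1) m) ⟩
      p * m * ((p ∸ 1) * ∏ₚ (_∸ 1) m)   ≡⟨ cong (p * m *_) (∏ₚ-*-∤ (_∸ 1) pp p∤m) ⟨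
      p * m * ∏ₚ (_∸ 1) (p * m)         ∎
      where
      open ≡-Reasoning
      regroup : ∀ a b c d → a * b * (c * d) ≡ c * (a * (b * d))
      regroup = solve-∀
      regroup′ : ∀ a b c d → a * (b * (c * d)) ≡ a * c * (b * d)
      regroup′ = solve-∀

  -- S₂ n divides by suc (rad n ∸ 1), which is rad n since rad n ≠ 0.
  m*n*o/suc[n∸1]≡m*o : ∀ m n o → .{{NonZero n}} → m * n * o / suc (n ∸ 1) ≡ m * o
  m*n*o/suc[n∸1]≡m*o m (suc n) o = trans (cong (_/ suc n) (swap m (suc n) o)) (m*n/n≡m (m * o) (suc n))
    where
    swap : ∀ a b c → a * b * c ≡ a * c * b
    swap = solve-∀

  φ-S₂-factorisation : ∀ n → .{{NonZero n}} →
    ∃ λ m → n ≡ m * rad n × φ n ≡ m * ∏ₚ (_∸ 1) n × S₂ n ≡ m * ∏ₚ (_∸ 2) n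
  φ-S₂-factorisation n = c , n≡c*rad , φ≡ , S₂≡
    where
    instance _ = rad≢0 n
    c = quotient (rad∣n n)
    n≡c*rad : n ≡ c * rad n
    n≡c*rad = m∣n⇒n≡quotient*m (rad∣n n)
    φ≡ : φ n ≡ c * ∏ₚ (_∸ 1) n
    φ≡ = *-cancelʳ-≡ (φ n) (c * ∏ₚ (_∸ 1) n) (rad n) (begin
      φ n * rad n                 ≡⟨ φ*rad≡n*∏ₚ[p∸1] n ⟩
      n * ∏ₚ (_∸ 1) n             ≡⟨ cong (_* ∏ₚ (_∸ 1) n) n≡c*rad ⟩
      c * rad n * ∏ₚ (_∸ 1) n     ≡⟨ swap c (rad n) (∏ₚ (_∸ 1) n) ⟩
      c * ∏ₚ (_∸ 1) n * rad n     ∎)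
      where
      open ≡-Reasoning
      swap : ∀ a b c → a * b * c ≡ a * c * b
      swap = solve-∀
    S₂≡ : S₂ n ≡ c * ∏ₚ (_∸ 2) n
    S₂≡ = trans (cong (λ t → t * ∏ₚ (_∸ 2) n / suc (rad n ∸ 1)) n≡c*rad) (m*n*o/suc[n∸1]≡m*o c (rad n) _)

  S₂[even]≡0 : .{{NonZero n}} → 2 ∣ n → S₂ n ≡ 0
  S₂[even]≡0 {n} 2∣n with φ-S₂-factorisation n
  ... | c , _ , _ , S₂≡ = trans S₂≡ (trans (cong (c *_) (∏ₚ[p∸2]≡0 2∣n)) (*-zeroʳ c))

  -- Parity, and the case φ(n) = S₂(n) + 1

  φ≡k*S₂+1⇒odd : Composite n → φ n ≡ k * S₂ n + 1 → ¬ 2 ∣ n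
  φ≡k*S₂+1⇒odd {n} {k} comp eq 2∣n = φ≢1 comp (begin
    φ n            ≡⟨ eq ⟩
    k * S₂ n + 1   ≡⟨ cong (λ t → k * t + 1) (S₂[even]≡0 {{composite⇒nonZero comp}} 2∣n) ⟩
    k * 0 + 1      ≡⟨ cong (_+ 1) (*-zeroʳ k) ⟩
    1              ∎)
    where open ≡-Reasoning

  m*a≡m*b+1⇒m≡1∧a≡b+1 : ∀ m a b → m * a ≡ m * b + 1 → m ≡ 1 × a ≡ b + 1
  m*a≡m*b+1⇒m≡1∧a≡b+1 m a b eq = m*n≡1⇒m≡1 m (a ∸ b) m*[a∸b]≡1 , a≡b+1
    where
    m*[a∸b]≡1 : m * (a ∸ b) ≡ 1
    m*[a∸b]≡1 = trans (*-distribˡ-∸ m a b) (trans (cong (_∸ m * b) eq) (m+n∸m≡n (m * b) 1))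
    a∸b≡1 : a ∸ b ≡ 1
    a∸b≡1 = m*n≡1⇒n≡1 m (a ∸ b) m*[a∸b]≡1
    a≡b+1 : a ≡ b + 1
    a≡b+1 = begin
      a         ≡⟨ m∸n+n≡m {a} {b} (<⇒≤ (m∸n≢0⇒n<m (λ a∸b≡0 → 0≢1+n (trans (sym a∸b≡0) a∸b≡1)))) ⟨
      a ∸ b + b ≡⟨ cong (_+ b) a∸b≡1 ⟩
      1 + b     ≡⟨ +-comm 1 b ⟩
      b + 1     ∎
      where open ≡-Reasoning

  -- (q - 1) C - (q - 2) A = C + (q - 2)(C - A) ≥ C.
  [q∸1]*C≡[q∸2]*A+1⇒C≤1 : ∀ q C A → 3 ≤ q → A ≤ C → (q ∸ 1) * C ≡ (q ∸ 2) * A + 1 → C ≤ 1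
  [q∸1]*C≡[q∸2]*A+1⇒C≤1 (suc (suc r)) C A _ A≤C eq = +-cancelʳ-≤ (r * C) C 1 (begin
    C + r * C ≡⟨ eq ⟩
    r * A + 1 ≤⟨ +-monoˡ-≤ 1 (*-monoʳ-≤ r A≤C) ⟩
    r * C + 1 ≡⟨ +-comm (r * C) 1 ⟩
    1 + r * C ∎)
    where open ≤-Reasoning

  ∏[x∸1]≡∏[x∸2]+1⇒singleton : ∀ xs → All (3 ≤_) xs →
    product (map (_∸ 1) xs) ≡ product (map (_∸ 2) xs) + 1 → ∃ λ q → xs ≡ q ∷ []
  ∏[x∸1]≡∏[x∸2]+1⇒singleton []               _                  ()
  ∏[x∸1]≡∏[x∸2]+1⇒singleton (q ∷ [])         _                  _  = q , refl
  ∏[x∸1]≡∏[x∸2]+1⇒singleton (q ∷ x ∷ xs) (3≤q ∷ 3≤x ∷ 3≤xs) eq = ⊥-elim (<⇒≱ 2≤C C≤1)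
    where
    C = product (map (_∸ 1) (x ∷ xs))
    A = product (map (_∸ 2) (x ∷ xs))
    A≤C : A ≤ C
    A≤C = product-map-mono (All.map (λ {y} _ → ∸-monoʳ-≤ y (s≤s z≤n)) (3≤x ∷ 3≤xs))
    C≤1 : C ≤ 1
    C≤1 = [q∸1]*C≡[q∸2]*A+1⇒C≤1 q C A 3≤q A≤C eq
    2≤C : 2 ≤ C
    2≤C = *-mono-≤ (∸-monoˡ-≤ 1 3≤x)
                   (product-map-≥1 (All.map (∸-monoˡ-≤ 1 ∘′ ≤-trans (s≤s (s≤s z≤n))) 3≤xs))

  φ≢S₂+1 : Composite n → φ n ≢ S₂ n + 1
  φ≢S₂+1 {n} comp eq
    with odd ← φ≡k*S₂+1⇒odd {k = 1} comp (trans eq (cong (_+ 1) (sym (*-identityˡ (S₂ n)))))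
    with c , n≡c*rad , φ≡ , S₂≡ ← φ-S₂-factorisation n {{composite⇒nonZero comp}}
    with c≡1 , C≡A+1 ← m*a≡m*b+1⇒m≡1∧a≡b+1 c (∏ₚ (_∸ 1) n) (∏ₚ (_∸ 2) n)
                          (trans (sym φ≡) (trans eq (cong (_+ 1) S₂≡)))
    with q , primeDivisors≡[q] ← ∏[x∸1]≡∏[x∸2]+1⇒singleton (primeDivisors n)
                                   (all-primeDivisors n (odd⇒3≤primeDivisor odd)) C≡A+1
    = composite⇒¬prime comp (subst Prime (sym n≡q) (proj₁ (∈-primeDivisors⁻ {n = n} q∈)))
    where
    q∈ : q ∈ primeDivisors n
    q∈ = subst (q ∈_) (sym primeDivisors≡[q]) (here refl)
    n≡q : n ≡ q
    n≡q = begin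
      n                             ≡⟨ n≡c*rad ⟩
      c * product (primeDivisors n) ≡⟨ cong₂ (λ a xs → a * product xs) c≡1 primeDivisors≡[q] ⟩
      1 * (q * 1)                   ≡⟨ *-identityˡ (q * 1) ⟩
      q * 1                         ≡⟨ *-identityʳ q ⟩
      q                             ∎
      where open ≡-Reasoning

  -- Size estimates

  cutoff : ℕ → ℕ → ℕ → ℕ
  cutoff T a x with x <? T
  ... | yes _ = a
  ... | no _  = 1

  product-cutoff-upTo : ∀ {T a} → 1 ≤ a → ∀ N → product (map (cutoff T a) (upTo N)) ≤ a ^ (N ⊓ T)
  product-cutoff-upTo         _   zero    = ≤-refl
  product-cutoff-upTo {T} {a} 1≤a (suc N) = begin
    product (map (cutoff T a) (upTo (suc N)))               ≡⟨ cong (product ∘′ map (cutoff T a)) (upTo-∷ʳ N) ⟨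
    product (map (cutoff T a) (upTo N ∷ʳ N))                ≡⟨ cong product (map-++ (cutoff T a) (upTo N) (N ∷ [])) ⟩
    product (map (cutoff T a) (upTo N) ++ cutoff T a N ∷ []) ≡⟨ product-++ (map (cutoff T a) (upTo N)) _ ⟩
    product (map (cutoff T a) (upTo N)) * (cutoff T a N * 1) ≤⟨ *-monoˡ-≤ _ (product-cutoff-upTo 1≤a N) ⟩
    a ^ (N ⊓ T) * (cutoff T a N * 1)                        ≤⟨ last-factor ⟩
    a ^ (suc N ⊓ T)                                         ∎
    where
    open ≤-Reasoning
    last-factor : a ^ (N ⊓ T) * (cutoff T a N * 1) ≤ a ^ (suc N ⊓ T)
    last-factor with N <? T
    ... | yes N<T rewrite m≤n⇒m⊓n≡m (<⇒≤ N<T) | m≤n⇒m⊓n≡m N<T =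
      ≤-reflexive (trans (cong (a ^ N *_) (*-identityʳ a)) (*-comm (a ^ N) a))
    ... | no N≮T  rewrite m≥n⇒m⊓n≡n (≮⇒≥ N≮T) | m≥n⇒m⊓n≡n (m≤n⇒m≤1+n (≮⇒≥ N≮T)) =
      ≤-reflexive (*-identityʳ (a ^ T))

  cutoff≥1 : ∀ {T a} → 1 ≤ a → ∀ x → 1 ≤ cutoff T a x
  cutoff≥1 {T} 1≤a x with x <? T
  ... | yes _ = 1≤a
  ... | no _  = ≤-refl

  ∏ₚ-cutoff≤a^T : ∀ {T a} → 1 ≤ a → ∀ n → ∏ₚ (cutoff T a) n ≤ a ^ T
  ∏ₚ-cutoff≤a^T {T} {a} 1≤a n = begin
    product (map (cutoff T a) (filter (primeDivisor? n) (upTo (suc n))))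
      ≤⟨ product-map-filter-≤ (primeDivisor? n) (cutoff T a) (cutoff≥1 1≤a) (upTo (suc n)) ⟩
    product (map (cutoff T a) (upTo (suc n)))  ≤⟨ product-cutoff-upTo {T} 1≤a (suc n) ⟩
    a ^ (suc n ⊓ T)                            ≤⟨ ^-monoʳ-≤ a {{>-nonZero 1≤a}} (m⊓n≤n (suc n) T) ⟩
    a ^ T                                      ∎
    where open ≤-Reasoning

  x≤3*[x∸2] : ∀ x → 3 ≤ x → x ≤ 3 * (x ∸ 2)
  x≤3*[x∸2] 1                   (s≤s ())
  x≤3*[x∸2] 2                   (s≤s (s≤s ()))
  x≤3*[x∸2] (suc (suc (suc y))) _ = subst (suc (suc (suc y)) ≤_) (sym (*-suc 3 y)) (+-monoʳ-≤ 3 (m≤n*m y 3))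

  x^D≤3^D*[x∸2]^D : ∀ D x → 3 ≤ x → x ^ D ≤ 3 ^ D * (x ∸ 2) ^ D
  x^D≤3^D*[x∸2]^D D x 3≤x = subst (x ^ D ≤_) (^-distribʳ-* 3 (x ∸ 2) D) (^-monoˡ-≤ D (x≤3*[x∸2] x 3≤x))

  x^D≤cutoff*x*[x∸2]^D : ∀ D x → 3 ≤ x → x ^ D ≤ cutoff (3 ^ D) (3 ^ D) x * (x * (x ∸ 2) ^ D)
  x^D≤cutoff*x*[x∸2]^D D x 3≤x with x <? 3 ^ D
  ... | yes _ =
    ≤-trans (x^D≤3^D*[x∸2]^D D x 3≤x) (*-monoʳ-≤ (3 ^ D) (m≤n*m _ x {{>-nonZero (≤-trans (s≤s z≤n) 3≤x)}}))
  ... | no x≮3^D = begin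
    x ^ D                 ≤⟨ x^D≤3^D*[x∸2]^D D x 3≤x ⟩
    3 ^ D * (x ∸ 2) ^ D   ≤⟨ *-monoˡ-≤ _ (≮⇒≥ x≮3^D) ⟩
    x * (x ∸ 2) ^ D       ≡⟨ *-identityˡ _ ⟨
    1 * (x * (x ∸ 2) ^ D) ∎
    where open ≤-Reasoning

  -- Only the fewer than 3^D primes below 3^D contribute the extra factor 3^D.
  rad-power-bound : ∀ D → ¬ 2 ∣ n → rad n ^ D ≤ (3 ^ D) ^ (3 ^ D) * (rad n * ∏ₚ (_∸ 2) n ^ D)
  rad-power-bound {n} D odd = begin
    rad n ^ D
      ≡⟨ cong (_^ D) (rad≡∏ₚid n) ⟩
    ∏ₚ id n ^ D
      ≡⟨ product-map-^ id D (primeDivisors n) ⟨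
    ∏ₚ (_^ D) n
      ≤⟨ ∏ₚ-mono (_^ D) (λ x → c x * (x * (x ∸ 2) ^ D)) n
                 (λ px x∣n → x^D≤cutoff*x*[x∸2]^D D _ (odd⇒3≤primeDivisor odd px x∣n)) ⟩
    ∏ₚ (λ x → c x * (x * (x ∸ 2) ^ D)) n
      ≡⟨ product-map-* c (λ x → x * (x ∸ 2) ^ D) (primeDivisors n) ⟩
    ∏ₚ c n * ∏ₚ (λ x → x * (x ∸ 2) ^ D) n
      ≡⟨ cong (∏ₚ c n *_) (product-map-* id (λ x → (x ∸ 2) ^ D) (primeDivisors n)) ⟩
    ∏ₚ c n * (∏ₚ id n * ∏ₚ (λ x → (x ∸ 2) ^ D) n)
      ≡⟨ cong₂ (λ u v → ∏ₚ c n * (u * v)) (rad≡∏ₚid n) (sym (product-map-^ (_∸ 2) D (primeDivisors n))) ⟨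
    ∏ₚ c n * (rad n * ∏ₚ (_∸ 2) n ^ D)
      ≤⟨ *-monoˡ-≤ _ (∏ₚ-cutoff≤a^T {3 ^ D} (m^n>0 3 D) n) ⟩
    (3 ^ D) ^ (3 ^ D) * (rad n * ∏ₚ (_∸ 2) n ^ D)
      ∎
    where
    open ≤-Reasoning
    c = cutoff (3 ^ D) (3 ^ D)

  c*B*A^[1+ℓ]≤M*B^[1+ℓ] : ∀ c A B k M ℓ → c * A ≤ M * k ^ ℓ → k * A ≤ B →
                          c * B * A ^ suc ℓ ≤ M * B ^ suc ℓ
  c*B*A^[1+ℓ]≤M*B^[1+ℓ] c A B k M ℓ c*A≤M*k^ℓ k*A≤B = begin
    c * B * (A * A ^ ℓ)       ≡⟨ regroup c B A (A ^ ℓ) ⟩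
    c * A * A ^ ℓ * B         ≤⟨ *-monoˡ-≤ B (*-monoˡ-≤ (A ^ ℓ) c*A≤M*k^ℓ) ⟩
    M * k ^ ℓ * A ^ ℓ * B     ≡⟨ cong (_* B) (trans (*-assoc M (k ^ ℓ) (A ^ ℓ)) (cong (M *_) (sym (^-distribʳ-* k A ℓ)))) ⟩
    M * (k * A) ^ ℓ * B       ≤⟨ *-monoˡ-≤ B (*-monoʳ-≤ M (^-monoˡ-≤ ℓ k*A≤B)) ⟩
    M * B ^ ℓ * B             ≡⟨ regroup′ M (B ^ ℓ) B ⟩
    M * (B * B ^ ℓ)           ∎
    where
    open ≤-Reasoning
    regroup : ∀ c B A a → c * B * (A * a) ≡ c * A * a * B
    regroup = solve-∀
    regroup′ : ∀ M b B → M * b * B ≡ M * (B * b)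
    regroup′ = solve-∀

  -- (n X)² ≤ (M Y)² ≤ M² K B X² ≤ M² K n X², then cancel n X².
  square-bound : ∀ {n X Y B} M K → 1 ≤ n → 1 ≤ X → n * X ≤ M * Y → Y * Y ≤ K * (B * (X * X)) → B ≤ n →
                 n ≤ M * M * K
  square-bound {n} {X} {Y} {B} M K 1≤n 1≤X n*X≤M*Y Y*Y≤ B≤n =
    *-cancelʳ-≤ n (M * M * K) (n * (X * X)) {{>-nonZero (*-mono-≤ 1≤n (*-mono-≤ 1≤X 1≤X))}} (begin
      n * (n * (X * X))           ≡⟨ regroup n X ⟩
      n * X * (n * X)             ≤⟨ *-mono-≤ n*X≤M*Y n*X≤M*Y ⟩
      M * Y * (M * Y)             ≡⟨ regroup′ M Y ⟩
      M * M * (Y * Y)             ≤⟨ *-monoʳ-≤ (M * M) Y*Y≤ ⟩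
      M * M * (K * (B * (X * X))) ≤⟨ *-monoʳ-≤ (M * M) (*-monoʳ-≤ K (*-monoˡ-≤ (X * X) B≤n)) ⟩
      M * M * (K * (n * (X * X))) ≡⟨ *-assoc (M * M) K _ ⟨
      M * M * K * (n * (X * X))   ∎)
    where
    open ≤-Reasoning
    regroup : ∀ n X → n * (n * (X * X)) ≡ n * X * (n * X)
    regroup = solve-∀
    regroup′ : ∀ M Y → M * Y * (M * Y) ≡ M * M * (Y * Y)
    regroup′ = solve-∀

  -- With n = c·rad n, S₂ = c A and φ = c C = k c A + 1, so k A < C ≤ rad n.
  odd-solution-bound : ∀ ℓ M → .{{NonZero n}} → ¬ 2 ∣ n → φ n ≡ k * S₂ n + 1 → S₂ n ≤ M * k ^ ℓ →
                       n ≤ M * M * (3 ^ (suc ℓ + suc ℓ)) ^ (3 ^ (suc ℓ + suc ℓ))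
  odd-solution-bound {n} {k} ℓ M odd φ≡ S₂≤ with φ-S₂-factorisation n
  ... | c , n≡c*B , φ≡c*C , S₂≡c*A =
    square-bound M _ (>-nonZero⁻¹ n) 1≤A^E n*A^E≤M*B^E B^E*B^E≤ (∣⇒≤ (rad∣n n))
    where
    E = suc ℓ
    B = rad n
    C = ∏ₚ (_∸ 1) n
    A = ∏ₚ (_∸ 2) n
    k*A<C : k * A < C
    k*A<C = *-cancelˡ-< c (k * A) C (begin-strict
      c * (k * A)     ≡⟨ x*[y*z]≡y*[x*z] c k A ⟩
      k * (c * A)     <⟨ m<m+n (k * (c * A)) (s≤s z≤n) ⟩
      k * (c * A) + 1 ≡⟨ cong (λ t → k * t + 1) S₂≡c*A ⟨
      k * S₂ n + 1    ≡⟨ φ≡ ⟨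
      φ n             ≡⟨ φ≡c*C ⟩
      c * C           ∎)
      where
      open ≤-Reasoning
      x*[y*z]≡y*[x*z] : ∀ x y z → x * (y * z) ≡ y * (x * z)
      x*[y*z]≡y*[x*z] = solve-∀
    C≤B : C ≤ B
    C≤B = subst (C ≤_) (sym (rad≡∏ₚid n)) (∏ₚ-mono (_∸ 1) id n (λ {p} _ _ → m∸n≤m p 1))
    n*A^E≤M*B^E : n * A ^ E ≤ M * B ^ E
    n*A^E≤M*B^E = subst (λ t → t * A ^ E ≤ M * B ^ E) (sym n≡c*B)
      (c*B*A^[1+ℓ]≤M*B^[1+ℓ] c A B k M ℓ (subst (_≤ M * k ^ ℓ) S₂≡c*A S₂≤) (≤-trans (<⇒≤ k*A<C) C≤B))
    1≤A^E : 1 ≤ A ^ E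
    1≤A^E = m^n>0 A {{>-nonZero (∏ₚ-≥1 (_∸ 2) n (λ pp p∣n → ∸-monoˡ-≤ 2 (odd⇒3≤primeDivisor odd pp p∣n)))}} E
    B^E*B^E≤ : B ^ E * B ^ E ≤ (3 ^ (E + E)) ^ (3 ^ (E + E)) * (B * (A ^ E * A ^ E))
    B^E*B^E≤ = subst₂ (λ u v → u ≤ (3 ^ (E + E)) ^ (3 ^ (E + E)) * (B * v))
      (^-distribˡ-+-* B E E) (^-distribˡ-+-* A E E) (rad-power-bound (E + E) odd)

module _ where
  open import Data.Nat as ℕ using (ℕ; suc; _≤_; _<_; z≤n; s≤s)
  open import Data.Nat.Properties
    using ( +-comm; <-irrefl; ≤-trans; <-≤-trans; m<m+n; +-mono-≤; *-monoʳ-≤; *-distribʳ-+; *-cancelˡ-<; m≤n*m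
          ; m*n≡1⇒n≡1; m*n≡0⇒m≡0∨n≡0; module ≤-Reasoning)
  open import Data.Nat.Divisibility using (divides; ∣⇒≤) renaming (_∣_ to _∣ℕ_)
  open import Data.Integer using (ℤ; +_; _+_; _*_; _-_; -_; ∣_∣; 0ℤ; 1ℤ)
  open import Data.Integer.Properties using (+-identityˡ; pos-*; abs-*; ∣-i∣≡∣i∣; ∣i-j∣≤∣i∣+∣j∣; ∣i∣≡0⇒i≡0)
  open import Data.Integer.Divisibility using (_∣_)
  open import Data.Integer.Divisibility.Signed
    using (∣ᵤ⇒∣; ∣⇒∣ᵤ; ∣n⇒∣m*n; ∣m∣n⇒∣m-n; ∣-refl) renaming (_∣_ to _∣ₛ_)
  open import Data.Integer.Tactic.RingSolver using (solve-∀)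

  +b∣+a-1⇒a≡k*b+1 : ∀ {a b} → 1 ≤ a → (+ b) ∣ (+ a - + 1) → ∃ λ k → a ≡ k ℕ.* b ℕ.+ 1
  +b∣+a-1⇒a≡k*b+1 {suc a} _ (divides k a≡k*b) = k , trans (cong suc a≡k*b) (+-comm 1 _)

  -- For P = c₀ + c₁ X + ⋯ + c_d X^d: negInv k P = Σᵢ (-1)ⁱ cᵢ k^(d-i), i.e. k^d P(-1/k).
  negInv : ℕ → Poly → ℤ
  negInv k []       = 0ℤ
  negInv k (c ∷ cs) = c * + (k ℕ.^ length cs) - negInv k cs

  ‖_‖₁ : Poly → ℕ
  ‖ [] ‖₁     = 0
  ‖ c ∷ cs ‖₁ = ∣ c ∣ ℕ.+ ‖ cs ‖₁

  -- Modulo k x + 1 one has k x ≡ -1, so k^(d+1) P(x) ≡ k · k^d P(-1/k).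
  k^len*P≡k*negInv[mod-kx+1] : ∀ k x cs →
    ∃ λ q → + (k ℕ.^ length cs) * eval cs x ≡ + k * negInv k cs + q * (+ k * x + 1ℤ)
  k^len*P≡k*negInv[mod-kx+1] k x []       = 0ℤ , base (+ k) x
    where
    base : ∀ K x → + 1 * 0ℤ ≡ K * 0ℤ + 0ℤ * (K * x + 1ℤ)
    base = solve-∀
  k^len*P≡k*negInv[mod-kx+1] k x (c ∷ cs) with k^len*P≡k*negInv[mod-kx+1] k x cs
  ... | q , eq = + k * negInv k cs + + k * x * q , (begin
    + (k ℕ.* W) * (c + x * eval cs x)               ≡⟨ cong (_* (c + x * eval cs x)) (pos-* k W) ⟩
    + k * + W * (c + x * eval cs x)                 ≡⟨ expand (+ k) (+ W) c x (eval cs x) ⟩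
    + k * + W * c + + k * x * (+ W * eval cs x)     ≡⟨ cong (λ t → + k * + W * c + + k * x * t) eq ⟩
    + k * + W * c + + k * x * (+ k * negInv k cs + q * (+ k * x + 1ℤ))
                                                    ≡⟨ regroup (+ k) (+ W) c x (negInv k cs) q ⟩
    + k * (c * + W - negInv k cs) + (+ k * negInv k cs + + k * x * q) * (+ k * x + 1ℤ) ∎)
    where
    open ≡-Reasoning
    W = k ℕ.^ length cs
    expand : ∀ K W c x E → K * W * (c + x * E) ≡ K * W * c + K * x * (W * E)
    expand = solve-∀
    regroup : ∀ K W c x R q → K * W * c + K * x * (K * R + q * (K * x + 1ℤ)) ≡
                                K * (c * W - R) + (K * R + K * x * q) * (K * x + 1ℤ)
    regroup = solve-∀

  negInv≡±lead[mod-k] : ∀ k {a} cs → last cs ≡ just a →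
    ∃ λ ε → ∃ λ t → ∣ ε ∣ ≡ ∣ a ∣ × negInv k cs ≡ ε + t * + k
  negInv≡±lead[mod-k] k (c ∷ [])      refl = c , 0ℤ , refl , lead (+ k) c
    where
    lead : ∀ K c → c * + 1 - 0ℤ ≡ c + 0ℤ * K
    lead = solve-∀
  negInv≡±lead[mod-k] k (c ∷ c′ ∷ cs) lst with negInv≡±lead[mod-k] k (c′ ∷ cs) lst
  ... | ε , t , ∣ε∣≡∣a∣ , eq = - ε , c * + W - t , trans (∣-i∣≡∣i∣ ε) ∣ε∣≡∣a∣ , (begin
    c * + (k ℕ.* W) - negInv k (c′ ∷ cs)  ≡⟨ cong₂ (λ u v → c * u - v) (pos-* k W) eq ⟩
    c * (+ k * + W) - (ε + t * + k)       ≡⟨ regroup c (+ k) (+ W) ε t ⟩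
    - ε + (c * + W - t) * + k             ∎)
    where
    open ≡-Reasoning
    W = k ℕ.^ length cs
    regroup : ∀ c K W ε t → c * (K * W) - (ε + t * K) ≡ - ε + (c * W - t) * K
    regroup = solve-∀

  negInv≢0 : ∀ {k} P → Monic P → 2 ≤ k → negInv k P ≢ 0ℤ
  negInv≢0 {k} P monic 2≤k negInv≡0 with negInv≡±lead[mod-k] k P monic
  ... | ε , t , ∣ε∣≡1 , eq = <-irrefl (sym k≡1) 2≤k
    where
    t*k≡-ε : t * + k ≡ - ε
    t*k≡-ε = trans (isolate ε (t * + k)) (trans (cong (_- ε) (trans (sym eq) negInv≡0)) (+-identityˡ (- ε)))
      where
      isolate : ∀ ε u → u ≡ (ε + u) - ε
      isolate = solve-∀
    k≡1 : k ≡ 1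
    k≡1 = m*n≡1⇒n≡1 ∣ t ∣ k
      (trans (sym (abs-* t (+ k))) (trans (cong ∣_∣ t*k≡-ε) (trans (∣-i∣≡∣i∣ ε) ∣ε∣≡1)))

  ∣negInv∣≤‖P‖₁*k^len : ∀ {k} → 1 ≤ k → ∀ cs → ∣ negInv k cs ∣ ≤ ‖ cs ‖₁ ℕ.* k ℕ.^ length cs
  ∣negInv∣≤‖P‖₁*k^len         _   []       = z≤n
  ∣negInv∣≤‖P‖₁*k^len {k} 1≤k (c ∷ cs) = begin
    ∣ c * + W - negInv k cs ∣              ≤⟨ ∣i-j∣≤∣i∣+∣j∣ (c * + W) (negInv k cs) ⟩
    ∣ c * + W ∣ ℕ.+ ∣ negInv k cs ∣        ≡⟨ cong (ℕ._+ ∣ negInv k cs ∣) (abs-* c (+ W)) ⟩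
    ∣ c ∣ ℕ.* W ℕ.+ ∣ negInv k cs ∣        ≤⟨ +-mono-≤ (*-monoʳ-≤ ∣ c ∣ W≤k*W)
                                              (≤-trans (∣negInv∣≤‖P‖₁*k^len 1≤k cs) (*-monoʳ-≤ ‖ cs ‖₁ W≤k*W)) ⟩
    ∣ c ∣ ℕ.* (k ℕ.* W) ℕ.+ ‖ cs ‖₁ ℕ.* (k ℕ.* W) ≡⟨ *-distribʳ-+ (k ℕ.* W) ∣ c ∣ ‖ cs ‖₁ ⟨
    (∣ c ∣ ℕ.+ ‖ cs ‖₁) ℕ.* (k ℕ.* W)     ∎
    where
    open ≤-Reasoning
    W = k ℕ.^ length cs
    W≤k*W : W ≤ k ℕ.* W
    W≤k*W = m≤n*m W k {{ℕ.>-nonZero 1≤k}}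

  monic-root-bound : ∀ P {k S} → Monic P → 2 ≤ k → (+ (k ℕ.* S ℕ.+ 1)) ∣ eval P (+ S) →
                     S < ‖ P ‖₁ ℕ.* k ℕ.^ length P
  monic-root-bound P {k} {S} monic 2≤k d∣P[S] with q , eq ← k^len*P≡k*negInv[mod-kx+1] k (+ S) P =
    *-cancelˡ-< k S (‖ P ‖₁ ℕ.* k ℕ.^ length P) (<-≤-trans (m<m+n (k ℕ.* S) (s≤s z≤n)) d≤k*‖P‖₁*k^len)
    where
    d = k ℕ.* S ℕ.+ 1
    d≡ : + k * + S + 1ℤ ≡ + d
    d≡ = cong (_+ 1ℤ) (sym (pos-* k S))
    d∣k*negInv : + d ∣ₛ + k * negInv k P
    d∣k*negInv = subst (+ d ∣ₛ_) k^len*P-q*d≡k*negInv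
      (∣m∣n⇒∣m-n (∣n⇒∣m*n (+ (k ℕ.^ length P)) (∣ᵤ⇒∣ d∣P[S])) (∣n⇒∣m*n q ∣-refl))
      where
      open ≡-Reasoning
      cancel : ∀ a q d → a + q * d - q * d ≡ a
      cancel = solve-∀
      k^len*P-q*d≡k*negInv : + (k ℕ.^ length P) * eval P (+ S) - q * + d ≡ + k * negInv k P
      k^len*P-q*d≡k*negInv = begin
        + (k ℕ.^ length P) * eval P (+ S) - q * + d ≡⟨ cong₂ (λ u v → u - q * v) eq (sym d≡) ⟩
        + k * negInv k P + q * (+ k * + S + 1ℤ) - q * (+ k * + S + 1ℤ) ≡⟨ cancel (+ k * negInv k P) q _ ⟩
        + k * negInv k P ∎
    d∣k*∣negInv∣ : d ∣ℕ k ℕ.* ∣ negInv k P ∣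
    d∣k*∣negInv∣ = subst (d ∣ℕ_) (abs-* (+ k) (negInv k P)) (∣⇒∣ᵤ d∣k*negInv)
    k*∣negInv∣≢0 : k ℕ.* ∣ negInv k P ∣ ≢ 0
    k*∣negInv∣≢0 z with m*n≡0⇒m≡0∨n≡0 k z
    ... | inj₁ refl = <-irrefl refl (≤-trans (s≤s z≤n) 2≤k)
    ... | inj₂ ∣negInv∣≡0 = negInv≢0 P monic 2≤k (∣i∣≡0⇒i≡0 ∣negInv∣≡0)
    d≤k*‖P‖₁*k^len : d ≤ k ℕ.* (‖ P ‖₁ ℕ.* k ℕ.^ length P)
    d≤k*‖P‖₁*k^len = begin
      d                                   ≤⟨ ∣⇒≤ {{ℕ.≢-nonZero k*∣negInv∣≢0}} d∣k*∣negInv∣ ⟩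
      k ℕ.* ∣ negInv k P ∣                ≤⟨ *-monoʳ-≤ k (∣negInv∣≤‖P‖₁*k^len (≤-trans (s≤s z≤n) 2≤k) P) ⟩
      k ℕ.* (‖ P ‖₁ ℕ.* k ℕ.^ length P)   ∎
      where open ≤-Reasoning

open import Data.Nat using (ℕ; _≤_; _*_; _+_; _^_; suc; s≤s; z≤n)
open import Data.Nat.Properties using (*-identityˡ; ≤-trans; <⇒≤)
open import Data.Nat.Primality using (Composite; composite⇒nonZero)
open import Data.Integer using (+_; _-_)
open import Data.Integer.Divisibility using (_∣_)

theorem1p3 : (P : Poly) → Monic P → NonConstant P →
    ∃ λ (B : ℕ) → ∀ (n : ℕ) → Composite n →
      (+ S₂ n) ∣ (+ φ n - + 1) →
      (+ φ n) ∣ eval P (+ S₂ n) →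
      n ≤ B
theorem1p3 P monic _ = ‖ P ‖₁ * ‖ P ‖₁ * (3 ^ D) ^ (3 ^ D) , bound
  where
  D = suc (length P) + suc (length P)
  bound : ∀ n → Composite n → (+ S₂ n) ∣ (+ φ n - + 1) → (+ φ n) ∣ eval P (+ S₂ n) →
          n ≤ ‖ P ‖₁ * ‖ P ‖₁ * (3 ^ D) ^ (3 ^ D)
  bound n comp S₂∣φ-1 φ∣P[S₂]
    with +b∣+a-1⇒a≡k*b+1 {φ n} {S₂ n} (≤-trans (s≤s z≤n) (φ≥2 (composite⇒3≤ comp))) S₂∣φ-1
  ... | 0 , φ≡1 = ⊥-elim (φ≢1 comp φ≡1)
  ... | 1 , φ≡S₂+1 = ⊥-elim (φ≢S₂+1 comp (trans φ≡S₂+1 (cong (_+ 1) (*-identityˡ (S₂ n)))))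
  ... | k@(suc (suc _)) , φ≡k*S₂+1 =
    odd-solution-bound {n} {k} (length P) ‖ P ‖₁ {{composite⇒nonZero comp}}
      (φ≡k*S₂+1⇒odd {k = k} comp φ≡k*S₂+1) φ≡k*S₂+1
      (<⇒≤ (monic-root-bound P {k} {S₂ n} monic (s≤s (s≤s z≤n))
                             (subst (λ t → (+ t) ∣ eval P (+ S₂ n)) φ≡k*S₂+1 φ∣P[S₂])))
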